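{- Let $G$ be a nontrivial cyclic group of order $n$ and $\Gamma(G)$ its generator graph. Then $\Delta(\Gamma(G)) \ge \frac{|V(\Gamma(G))|}{2} = \frac{n}{2}$.
   Context: For a group $G$, the generator graph $\Gamma(G)$ is the simple undirected graph whose vertex set is the set of elements of $G$, in which two distinct elements $x,y$ are adjacent if and only if at least one of them generates $G$. $\Delta(\Gamma)$ denotes the maximum vertex degree of a graph $\Gamma$. -}

module Defs where

open import Level using (Level; _⊔_)
open import Algebra.Bundles using (Group)
open import Data.Nat using (ℕ; zero; suc; _*_; _≥_; _>_)
open import Data.Integer using (ℤ; +_; -[1+_])
open import Data.Fin using (Fin)
open import Data.Product using (Σ; ∃; _×_)
open import Data.Sum using (_⊎_)
open import Relation.Nullary using (¬_)
open import Relation.Binary.PropositionalEquality using (_≡_)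

module _ {c ℓ : Level} (G : Group c ℓ) where
  open Group G

  powℕ : Carrier → ℕ → Carrier
  powℕ x zero    = ε
  powℕ x (suc k) = x ∙ powℕ x k

  powℤ : Carrier → ℤ → Carrier
  powℤ x (+ k)      = powℕ x k
  powℤ x -[1+ k ]   = (powℕ x (suc k)) ⁻¹

  Generates : Carrier → Set (c ⊔ ℓ)
  Generates x = ∀ y → ∃ λ (z : ℤ) → y ≈ powℤ x z

  IsCyclic : Set (c ⊔ ℓ)
  IsCyclic = ∃ λ g → Generates g

  -- G is finite of order n: an enumeration Fin n → G that is a bijection (up to ≈)
  HasOrder : ℕ → Set (c ⊔ ℓ)
  HasOrder n = Σ (Fin n → Carrier) λ e →
                 (∀ i j → e i ≈ e j → i ≡ j) × (∀ x → ∃ λ i → x ≈ e i)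

  Adjacent : Carrier → Carrier → Set (c ⊔ ℓ)
  Adjacent x y = ¬ (x ≈ y) × (Generates x ⊎ Generates y)

  DegreeAtLeast : Carrier → ℕ → Set (c ⊔ ℓ)
  DegreeAtLeast x k = Σ (Fin k → Carrier) λ f →
                        (∀ i j → f i ≈ f j → i ≡ j) × (∀ i → Adjacent x (f i))

  MaxDegreeAtLeast : ℕ → Set (c ⊔ ℓ)
  MaxDegreeAtLeast k = ∃ λ x → DegreeAtLeast x k

  -- Δ(Γ(G)) ≥ n/2 (rational bound), i.e. 2·Δ ≥ n
  MaxDegreeAtLeastHalf : ℕ → Set (c ⊔ ℓ)
  MaxDegreeAtLeastHalf n = ∃ λ k → (2 * k ≥ n) × MaxDegreeAtLeast k

{-# OPTIONS --safe #-}
module Submission where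

open import Defs
open import Level using (Level)
open import Algebra.Bundles using (Group)
open import Data.Nat using (ℕ; suc; _+_; _*_; _≤_; _<_; _>_; s≤s)
open import Data.Nat.Properties using (+-identityʳ; +-monoˡ-≤; module ≤-Reasoning)
open import Data.Fin using (Fin; punchIn)
open import Data.Fin.Properties using (punchIn-injective; punchInᵢ≢i)
open import Data.Product using (_,_; proj₁; proj₂)
open import Data.Sum using (inj₁)
open import Relation.Binary.PropositionalEquality as ≡ using (_≡_)
open import Relation.Nullary using (¬_)

0<n⇒1+n≤2*n : ∀ {n} → 0 < n → 1 + n ≤ 2 * n
0<n⇒1+n≤2*n {n} 0<n = begin
  1 + n        ≤⟨ +-monoˡ-≤ n 0<n ⟩
  n + n        ≡⟨ ≡.cong (n +_) (+-identityʳ n) ⟨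
  2 * n        ∎
  where open ≤-Reasoning

module _ {c ℓ : Level} (G : Group c ℓ) where
  open Group G

  Generates⇒DegreeAtLeast : ∀ {k g} → HasOrder G (suc k) → Generates G g →
                            DegreeAtLeast G g k
  Generates⇒DegreeAtLeast {k} {g} (e , e-injective , e-surjective) g-generates =
    others , others-injective , λ i → g≉others i , inj₁ g-generates
    where
    i₀ : Fin (suc k)
    i₀ = proj₁ (e-surjective g)

    others : Fin k → Carrier
    others i = e (punchIn i₀ i)

    others-injective : ∀ i j → others i ≈ others j → i ≡ j
    others-injective i j p = punchIn-injective i₀ i j (e-injective _ _ p)

    g≈e[i₀] : g ≈ e i₀
    g≈e[i₀] = proj₂ (e-surjective g)

    g≉others : ∀ i → ¬ (g ≈ others i)
    g≉others i g≈others =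
      punchInᵢ≢i i₀ i (≡.sym (e-injective _ _ (trans (sym g≈e[i₀]) g≈others)))

corollary3p11 : {c ℓ : Level} (G : Group c ℓ) (n : ℕ) →
                HasOrder G n → n > 1 → IsCyclic G →
                MaxDegreeAtLeastHalf G n
corollary3p11 G (suc k) order (s≤s 0<k) (g , g-generates) =
  k , 0<n⇒1+n≤2*n 0<k , g , Generates⇒DegreeAtLeast G order g-generates
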